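{- Let $n\geq3$ and let $C_n$ be the (undirected) cycle on $n$ vertices. Then $dom^+_{maj}(C_n)=-n+2\lceil\frac{n+2}{4}\rceil$, and $DOM^+_{maj}(C_n)=2$ if $n$ is even and $DOM^+_{maj}(C_n)=3$ if $n$ is odd.
   Context: Digraphs are finite, without loops or multiple arcs. For a digraph $D=(V,A)$ and $u\in V$, $N^+[u]=\{u\}\cup\{v: uv\in A\}$; for $f:V\to\{ -1,1\}$ and $X\subseteq V$, $f(X)=\sum_{v\in X}f(v)$. A majority out-dominating function (MODF) of $D$ is $f:V\to\{ -1,1\}$ with $|\{v: f(N^+[v])\geq1\}|\geq|V|/2$; its weight is $f(V)$; $\gamma^+_{maj}(D)$ is the minimum weight of a MODF. An orientation of a graph $G=(V,E)$ is a digraph $(V,A)$ obtained by replacing each edge $uv$ by exactly one of the arcs $uv$, $vu$. $dom^+_{maj}(G)$ and $DOM^+_{maj}(G)$ are the minimum and maximum of $\gamma^+_{maj}(D)$ over all orientations $D$ of $G$. -}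

module Defs where

open import Data.Bool using (Bool; true; false; if_then_else_; _∨_; _∧_)
open import Data.Nat as ℕ using (ℕ; zero; suc; _≡ᵇ_)
open import Data.Fin using (Fin; zero; suc; toℕ)
open import Data.Integer as ℤ using (ℤ; +_; -_; _+_; _≤_)
open import Data.Integer.Properties using (_≤?_)
open import Data.Product using (Σ; _×_; _,_)
open import Data.Sum using (_⊎_)
open import Relation.Binary.PropositionalEquality using (_≡_)
open import Relation.Nullary.Decidable using (does)

Digraph : ℕ → Set
Digraph n = Fin n → Fin n → Bool

Graph : ℕ → Set
Graph n = Fin n → Fin n → Bool

Σℤ : (n : ℕ) → (Fin n → ℤ) → ℤ
Σℤ zero    g = + 0
Σℤ (suc n) g = g zero + Σℤ n (λ i → g (suc i))

Σℕ : (n : ℕ) → (Fin n → ℕ) → ℕ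
Σℕ zero    g = 0
Σℕ (suc n) g = g zero ℕ.+ Σℕ n (λ i → g (suc i))

-- A function f : V → {-1,1} is encoded as Fin n → Bool (true ↦ 1, false ↦ -1).
SignFun : ℕ → Set
SignFun n = Fin n → Bool

val : Bool → ℤ
val true  = + 1
val false = - (+ 1)

weight : (n : ℕ) → SignFun n → ℤ
weight n f = Σℤ n (λ v → val (f v))

-- f(N⁺[u]) = f(u) + Σ_{v : uv ∈ A} f(v)   (digraphs are loopless)
closedOutSum : (n : ℕ) → Digraph n → SignFun n → Fin n → ℤ
closedOutSum n D f u = val (f u) + Σℤ n (λ v → if D u v then val (f v) else + 0)

goodCount : (n : ℕ) → Digraph n → SignFun n → ℕ
goodCount n D f = Σℕ n (λ v → if does (+ 1 ≤? closedOutSum n D f v) then 1 else 0)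

-- MODF: |{ v : f(N⁺[v]) ≥ 1 }| ≥ |V|/2, i.e. 2·count ≥ n
IsMODF : (n : ℕ) → Digraph n → SignFun n → Set
IsMODF n D f = n ℕ.≤ 2 ℕ.* goodCount n D f

IsGammaMaj : (n : ℕ) → Digraph n → ℤ → Set
IsGammaMaj n D k =
  Σ (SignFun n) (λ f → IsMODF n D f × weight n f ≡ k)
  × ((f : SignFun n) → IsMODF n D f → k ≤ weight n f)

IsOrientation : (n : ℕ) → Graph n → Digraph n → Set
IsOrientation n G D =
  ((u v : Fin n) → D u v ≡ true → G u v ≡ true)
  × ((u v : Fin n) → G u v ≡ true →
       (D u v ≡ true × D v u ≡ false) ⊎ (D u v ≡ false × D v u ≡ true))

cycleGraph : (n : ℕ) → Graph n
cycleGraph n i j =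
  (toℕ j ≡ᵇ suc (toℕ i)) ∨ (toℕ i ≡ᵇ suc (toℕ j))
  ∨ ((toℕ i ≡ᵇ 0) ∧ (suc (toℕ j) ≡ᵇ n))
  ∨ ((toℕ j ≡ᵇ 0) ∧ (suc (toℕ i) ≡ᵇ n))

IsDomMaj : (n : ℕ) → Graph n → ℤ → Set
IsDomMaj n G k =
  Σ (Digraph n) (λ D → IsOrientation n G D × IsGammaMaj n D k)
  × ((D : Digraph n) → IsOrientation n G D → (j : ℤ) → IsGammaMaj n D j → k ≤ j)

IsDOMMaj : (n : ℕ) → Graph n → ℤ → Set
IsDOMMaj n G k =
  Σ (Digraph n) (λ D → IsOrientation n G D × IsGammaMaj n D k)
  × ((D : Digraph n) → IsOrientation n G D → (j : ℤ) → IsGammaMaj n D j → j ≤ k)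

module Submission where

-- An orientation of C_n is described by the direction of each edge {u, u+1} (`forward`),
-- and then goodness of u, f(N⁺[u]) ≥ 1, is a local rule `good` in u and its two neighbours
-- (goodCount-local); with p positive vertices the weight is 2p - n (weight-positives).
-- Lower bounds: a good -1 vertex is a source between two +1 vertices; charging it to its
-- successor shows #good ≤ 2p, with equality only for alternating signs, so a MODF has
-- 4p ≥ n + 2 (modf-positives). In the directed cycle #good ≤ p, with equality only if all
-- signs are +1, so 2p ≥ n + 2 or p = n (directed-positives).
-- Constructions: +1 on 0, 2, …, 2q with edges pointing into the +1 vertices makes
-- 0, …, 2q good (alternating-count); in every orientation a suitably rotated window of
-- K + 1 consecutive +1 vertices has K good vertices (window-modf).

open import Algebra.Properties.CommutativeSemigroup using (interchange)
open import Data.Bool using (Bool; true; false; not; _∧_; _∨_; if_then_else_)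
open import Data.Bool.Properties
  using (∨-identityʳ; ∨-zeroʳ; ∧-zeroʳ; ∧-conicalˡ; ∧-conicalʳ; not-involutive; ¬-not; T-≡; T-∨; T-∧)
  renaming (_≟_ to _≟ᵇ_)
open import Data.Empty using (⊥-elim)
open import Data.Fin using (Fin; zero; suc; toℕ; fromℕ; fromℕ<; inject₁)
open import Data.Fin.Properties using (toℕ-injective; toℕ<n; toℕ-fromℕ; toℕ-fromℕ<; toℕ-inject₁)
  renaming (_≟_ to _≟ᶠ_)
open import Data.Integer as ℤ using (ℤ; +_; -_) renaming (_+_ to _+ℤ_; _≤_ to _≤ℤ_)
import Data.Integer.Properties as ℤP
import Data.Integer.Tactic.RingSolver as ℤSolver
import Data.Nat.Tactic.RingSolver as ℕSolver
open import Data.Nat using (ℕ; zero; suc; _+_; _*_; _∸_; _/_; _%_; _≤_; _<_; _<ᵇ_; _≡ᵇ_; z≤n; s≤s)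
open import Data.Nat.Divisibility using (_∣_; divides)
open import Data.Nat.DivMod using (m≡m%n+[m/n]*n; m%n<n; m/n*n≤m; m<n*o⇒m/o<n)
open import Data.Nat.GeneralisedArithmetic using (fold; fold-+)
open import Data.Nat.Properties
open import Data.Product using (Σ; ∃; _×_; _,_; proj₁; proj₂)
open import Data.Sum using (_⊎_; inj₁; inj₂; [_,_])
open import Function using (_∘_; Equivalence)
open import Relation.Binary.PropositionalEquality
  using (_≡_; _≢_; refl; sym; trans; cong; cong₂; subst; module ≡-Reasoning)
open import Relation.Nullary using (¬_; yes; no; does)
open import Relation.Nullary.Decidable using (dec-true; dec-false)

open import Defs

ind : Bool → ℕ
ind b = if b then 1 else 0

ind-∧≤ : ∀ a b → ind (a ∧ b) ≤ ind a
ind-∧≤ true  true  = ≤-refl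
ind-∧≤ true  false = z≤n
ind-∧≤ false _     = z≤n

ind≡1 : ∀ {b} → ind b ≡ 1 → b ≡ true
ind≡1 {true} _ = refl

<ᵇ-true : ∀ {a b} → a < b → (a <ᵇ b) ≡ true
<ᵇ-true a<b = Equivalence.to T-≡ (<⇒<ᵇ a<b)

<ᵇ-sound : ∀ {a b} → (a <ᵇ b) ≡ true → a < b
<ᵇ-sound {a} {b} a<ᵇb = <ᵇ⇒< a b (Equivalence.from T-≡ a<ᵇb)

≡ᵇ-refl : ∀ a → (a ≡ᵇ a) ≡ true
≡ᵇ-refl a = Equivalence.to T-≡ (≡⇒≡ᵇ a a refl)

second-maximal : ∀ {a b c} → a ≤ c → b ≤ c → a + b ≡ c + c → b ≡ c
second-maximal {a} {b} {c} a≤c b≤c a+b≡2c =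
  ≤-antisym b≤c (+-cancelˡ-≤ c c b (≤-trans (≤-reflexive (sym a+b≡2c)) (+-monoˡ-≤ b a≤c)))

positives : (n : ℕ) → SignFun n → ℕ
positives n f = Σℕ n (λ i → ind (f i))

positive-or-none : ∀ n (f : SignFun n) → (∃ λ j → f j ≡ true) ⊎ (∀ j → f j ≡ false)
positive-or-none zero    f = inj₂ λ ()
positive-or-none (suc n) f with f zero in f0
... | true  = inj₁ (zero , f0)
... | false with positive-or-none n (f ∘ suc)
...   | inj₁ (j , fj) = inj₁ (suc j , fj)
...   | inj₂ none     = inj₂ λ { zero → f0 ; (suc j) → none j }

Σℕ-cong : ∀ n {g h : Fin n → ℕ} → (∀ i → g i ≡ h i) → Σℕ n g ≡ Σℕ n h
Σℕ-cong zero    eq = refl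
Σℕ-cong (suc n) eq = cong₂ _+_ (eq zero) (Σℕ-cong n (eq ∘ suc))

Σℕ-+ : ∀ n (g h : Fin n → ℕ) → Σℕ n (λ i → g i + h i) ≡ Σℕ n g + Σℕ n h
Σℕ-+ zero    g h = refl
Σℕ-+ (suc n) g h = trans (cong (λ s → g zero + h zero + s) (Σℕ-+ n (g ∘ suc) (h ∘ suc)))
                         (interchange +-commutativeSemigroup (g zero) (h zero) _ _)

Σℕ-zero : ∀ n → Σℕ n (λ _ → 0) ≡ 0
Σℕ-zero zero    = refl
Σℕ-zero (suc n) = Σℕ-zero n

no-positives : ∀ n {f : SignFun n} → (∀ j → f j ≡ false) → positives n f ≡ 0
no-positives n none = trans (Σℕ-cong n (cong ind ∘ none)) (Σℕ-zero n)

Σℕ-one : ∀ n → Σℕ n (λ _ → 1) ≡ n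
Σℕ-one zero    = refl
Σℕ-one (suc n) = cong suc (Σℕ-one n)

Σℕ-mono : ∀ n {g h : Fin n → ℕ} → (∀ i → g i ≤ h i) → Σℕ n g ≤ Σℕ n h
Σℕ-mono zero    le = z≤n
Σℕ-mono (suc n) le = +-mono-≤ (le zero) (Σℕ-mono n (le ∘ suc))

Σℕ-strict-or-equal : ∀ n {g h : Fin n → ℕ} → (∀ i → g i ≤ h i) →
  suc (Σℕ n g) ≤ Σℕ n h ⊎ (∀ i → g i ≡ h i)
Σℕ-strict-or-equal zero    le = inj₂ λ ()
Σℕ-strict-or-equal (suc n) le with m≤n⇒m<n∨m≡n (le zero)
... | inj₁ lt = inj₁ (+-mono-≤ lt (Σℕ-mono n (le ∘ suc)))
... | inj₂ eq with Σℕ-strict-or-equal n (le ∘ suc)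
...   | inj₁ lt = inj₁ (≤-trans (≤-reflexive (sym (+-suc _ _))) (+-mono-≤ (≤-reflexive eq) lt))
...   | inj₂ eqs = inj₂ λ { zero → eq ; (suc i) → eqs i }

Σℕ-last : ∀ m (g : Fin (suc m) → ℕ) → Σℕ (suc m) g ≡ Σℕ m (g ∘ inject₁) + g (fromℕ m)
Σℕ-last zero    g = +-comm (g zero) 0
Σℕ-last (suc m) g = trans (cong (λ s → g zero + s) (Σℕ-last m (g ∘ suc))) (sym (+-assoc (g zero) _ _))

count-mono : ∀ n {P Q : Fin n → Bool} → (∀ i → P i ≡ true → Q i ≡ true) →
  Σℕ n (λ i → ind (P i)) ≤ Σℕ n (λ i → ind (Q i))
count-mono n {P} {Q} P⇒Q = Σℕ-mono n ind-mono
  where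
  ind-mono : ∀ i → ind (P i) ≤ ind (Q i)
  ind-mono i with P i in Pi
  ... | false = z≤n
  ... | true  = ≤-reflexive (cong ind (sym (P⇒Q i Pi)))

count-below : ∀ n K → K ≤ n → Σℕ n (λ j → ind (toℕ j <ᵇ K)) ≡ K
count-below n       zero    _         = Σℕ-zero n
count-below (suc n) (suc K) (s≤s K≤n) = cong suc (count-below n K K≤n)

Σℤ-cong : ∀ n {g h : Fin n → ℤ} → (∀ i → g i ≡ h i) → Σℤ n g ≡ Σℤ n h
Σℤ-cong zero    eq = refl
Σℤ-cong (suc n) eq = cong₂ _+ℤ_ (eq zero) (Σℤ-cong n (eq ∘ suc))

Σℤ-+ : ∀ n (g h : Fin n → ℤ) → Σℤ n (λ i → g i +ℤ h i) ≡ Σℤ n g +ℤ Σℤ n h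
Σℤ-+ zero    g h = refl
Σℤ-+ (suc n) g h = trans (cong (λ s → g zero +ℤ h zero +ℤ s) (Σℤ-+ n (g ∘ suc) (h ∘ suc)))
                         (interchange ℤP.+-commutativeSemigroup (g zero) (h zero) _ _)

Σℤ-zero : ∀ n → Σℤ n (λ _ → + 0) ≡ + 0
Σℤ-zero zero    = refl
Σℤ-zero (suc n) = trans (ℤP.+-identityˡ _) (Σℤ-zero n)

Σℤ-single : ∀ n (c : Fin n) (x : ℤ) → Σℤ n (λ v → if does (v ≟ᶠ c) then x else + 0) ≡ x
Σℤ-single (suc n) zero    x = trans (cong (x +ℤ_) (Σℤ-zero n)) (ℤP.+-identityʳ x)
Σℤ-single (suc n) (suc c) x = trans (ℤP.+-identityˡ _) (Σℤ-single n c x)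

prev : ∀ {n} → Fin n → Fin n
prev {suc m} zero    = fromℕ m
prev {suc m} (suc i) = inject₁ i

-- The successor is kept opaque: all reasoning about it goes through next-cases.
opaque
  next : ∀ {n} → Fin n → Fin n
  next {suc m} i with toℕ i <? m
  ... | yes i<m = fromℕ< (s≤s i<m)
  ... | no  _   = zero

  next-cases : ∀ {m} (i : Fin (suc m)) →
    (toℕ i < m × toℕ (next i) ≡ suc (toℕ i)) ⊎ (toℕ i ≡ m × next i ≡ zero)
  next-cases {m} i with toℕ i <? m
  ... | yes i<m = inj₁ (i<m , toℕ-fromℕ< (s≤s i<m))
  ... | no  i≮m = inj₂ (≤-antisym (≤-pred (toℕ<n i)) (≮⇒≥ i≮m) , refl)

next-inject₁ : ∀ {m} (i : Fin m) → next (inject₁ i) ≡ suc i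
next-inject₁ i with next-cases (inject₁ i)
... | inj₁ (_ , eq) = toℕ-injective (trans eq (cong suc (toℕ-inject₁ i)))
... | inj₂ (last , _) = ⊥-elim (<-irrefl (trans (sym (toℕ-inject₁ i)) last) (toℕ<n i))

next-fromℕ : ∀ m → next (fromℕ m) ≡ zero
next-fromℕ m with next-cases (fromℕ m)
... | inj₁ (lt , _) = ⊥-elim (<-irrefl (toℕ-fromℕ m) lt)
... | inj₂ (_ , eq) = eq

next-prev : ∀ {n} (i : Fin n) → next (prev i) ≡ i
next-prev {suc m} zero    = next-fromℕ m
next-prev {suc m} (suc i) = next-inject₁ i

prev-next : ∀ {n} (i : Fin n) → prev (next i) ≡ i
prev-next {suc m} i with next i | next-cases i
... | _     | inj₂ (last , refl) = toℕ-injective (trans (toℕ-fromℕ m) (sym last))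
... | zero  | inj₁ (_ , ())
... | suc j | inj₁ (_ , eq) = toℕ-injective (trans (toℕ-inject₁ j) (suc-injective eq))

toℕ-next≤ : ∀ {m} (j : Fin (suc m)) → toℕ (next j) ≤ suc (toℕ j)
toℕ-next≤ j with next-cases j
... | inj₁ (_ , j+1) = ≤-reflexive j+1
... | inj₂ (_ , wrap) rewrite wrap = z≤n

next-next≢ : ∀ {n} → 3 ≤ n → (i : Fin n) → next (next i) ≢ i
next-next≢ {suc m} (s≤s 2≤m) i eq with next-cases i | next-cases (next i)
... | inj₁ (_ , i+1) | inj₁ (_ , i+2) =
  k≢2+k (toℕ i) (trans (cong toℕ (sym eq)) (trans i+2 (cong suc i+1)))
  where k≢2+k : ∀ k → k ≢ suc (suc k)
        k≢2+k zero    ()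
        k≢2+k (suc k) e = k≢2+k k (suc-injective e)
... | inj₁ (_ , i+1) | inj₂ (last , wrap) =
  <-irrefl (sym (trans (sym last) (trans i+1 (cong (suc ∘ toℕ) (trans (sym eq) wrap))))) 2≤m
... | inj₂ (last , wrap) | inj₁ (_ , i+2) =
  <-irrefl (sym (trans (sym last) (trans (cong toℕ (sym eq)) (trans i+2 (cong (suc ∘ toℕ) wrap))))) 2≤m
... | inj₂ (_ , wrap) | inj₂ (last , _) =
  <-irrefl (sym (trans (sym last) (cong toℕ wrap))) (≤-trans (s≤s z≤n) 2≤m)

next≢prev : ∀ {n} → 3 ≤ n → (i : Fin n) → next i ≢ prev i
next≢prev n≥3 i eq = next-next≢ n≥3 i (trans (cong next eq) (next-prev i))

rotate unrotate : ∀ {n} → ℕ → Fin n → Fin n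
rotate   r j = fold j next r
unrotate r j = fold j prev r

fold-comm : ∀ {A : Set} (s g : A → A) → (∀ y → s (g y) ≡ g (s y)) →
  ∀ x r → fold (g x) s r ≡ g (fold x s r)
fold-comm s g comm x zero    = refl
fold-comm s g comm x (suc r) = trans (cong s (fold-comm s g comm x r)) (comm _)

fold-preserves : ∀ {A : Set} (s : A → A) (Q : A → Set) → (∀ x → Q x → Q (s x)) →
  ∀ {x} → Q x → ∀ r → Q (fold x s r)
fold-preserves s Q step qx zero    = qx
fold-preserves s Q step qx (suc r) = step _ (fold-preserves s Q step qx r)

prev-next-comm : ∀ {n} (y : Fin n) → prev (next y) ≡ next (prev y)
prev-next-comm y = trans (prev-next y) (sym (next-prev y))

rotate-next : ∀ {n} r (j : Fin n) → next (rotate r j) ≡ rotate r (next j)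
rotate-next r j = sym (fold-comm next next (λ _ → refl) j r)

rotate-prev : ∀ {n} r (j : Fin n) → prev (rotate r j) ≡ rotate r (prev j)
rotate-prev r j = sym (fold-comm next prev (λ y → sym (prev-next-comm y)) j r)

unrotate-rotate : ∀ {n} r (j : Fin n) → unrotate r (rotate r j) ≡ j
unrotate-rotate zero    j = refl
unrotate-rotate (suc r) j = begin
  prev (fold (next (rotate r j)) prev r)  ≡⟨ cong prev (fold-comm prev next prev-next-comm (rotate r j) r) ⟩
  prev (next (unrotate r (rotate r j)))   ≡⟨ prev-next _ ⟩
  unrotate r (rotate r j)                 ≡⟨ unrotate-rotate r j ⟩
  j                                       ∎
  where open ≡-Reasoning

toℕ-rotate : ∀ {m} (j : Fin (suc m)) k → toℕ j + k ≤ m → toℕ (rotate k j) ≡ toℕ j + k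
toℕ-rotate j zero    _  = sym (+-identityʳ _)
toℕ-rotate j (suc k) le
  with k<m ← ≤-trans (≤-reflexive (sym (+-suc (toℕ j) k))) le
  with next-cases (rotate k j) | toℕ-rotate j k (<⇒≤ k<m)
... | inj₁ (_ , step) | walked = trans step (trans (cong suc walked) (sym (+-suc _ k)))
... | inj₂ (last , _) | walked = ⊥-elim (<-irrefl (trans (sym walked) last) k<m)

rotate-from-zero : ∀ {m} (i : Fin (suc m)) → rotate (toℕ i) zero ≡ i
rotate-from-zero i = toℕ-injective (toℕ-rotate zero (toℕ i) (≤-pred (toℕ<n i)))

reachable : ∀ {n} (j i : Fin n) → ∃ λ r → rotate r j ≡ i
reachable {suc m} j i = toℕ i + suc (m ∸ toℕ j) , (begin
  fold j next (toℕ i + suc (m ∸ toℕ j))   ≡⟨ fold-+ j next (toℕ i) ⟩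
  rotate (toℕ i) (rotate (suc (m ∸ toℕ j)) j) ≡⟨ cong (rotate (toℕ i)) j↦0 ⟩
  rotate (toℕ i) zero                     ≡⟨ rotate-from-zero i ⟩
  i                                       ∎)
  where
  open ≡-Reasoning
  j≤m = ≤-pred (toℕ<n j)
  j↦0 : rotate (suc (m ∸ toℕ j)) j ≡ zero
  j↦0 with next-cases (rotate (m ∸ toℕ j) j)
  ... | inj₂ (_ , wrap) = wrap
  ... | inj₁ (lt , _) = ⊥-elim (<-irrefl (trans (toℕ-rotate j (m ∸ toℕ j) (≤-reflexive (m+[n∸m]≡n j≤m)))
                                                 (m+[n∸m]≡n j≤m)) lt)

propagate-next : ∀ {n} (Q : Fin n → Set) → (∀ i → Q i → Q (next i)) →
  ∀ {j} → Q j → ∀ i → Q i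
propagate-next Q step {j} qj i with reachable j i
... | r , j↦i = subst Q j↦i (fold-preserves next Q step qj r)

propagate-prev : ∀ {n} (Q : Fin n → Set) → (∀ i → Q i → Q (prev i)) →
  ∀ {j} → Q j → ∀ i → Q i
propagate-prev Q step {j} qj i with reachable i j
... | r , i↦j = subst Q (trans (cong (unrotate r) (sym i↦j)) (unrotate-rotate r i))
                        (fold-preserves prev Q step qj r)

Σℕ-next : ∀ n (h : Fin n → ℕ) → Σℕ n (h ∘ next) ≡ Σℕ n h
Σℕ-next zero    h = refl
Σℕ-next (suc m) h = begin
  Σℕ (suc m) (h ∘ next)                          ≡⟨ Σℕ-last m (h ∘ next) ⟩
  Σℕ m (h ∘ next ∘ inject₁) + h (next (fromℕ m)) ≡⟨ cong₂ _+_ (Σℕ-cong m (cong h ∘ next-inject₁))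
                                                                (cong h (next-fromℕ m)) ⟩
  Σℕ m (h ∘ suc) + h zero                        ≡⟨ +-comm _ (h zero) ⟩
  Σℕ (suc m) h                                   ∎
  where open ≡-Reasoning

Σℕ-prev : ∀ n (h : Fin n → ℕ) → Σℕ n (h ∘ prev) ≡ Σℕ n h
Σℕ-prev n h = trans (sym (Σℕ-next n (h ∘ prev))) (Σℕ-cong n (cong h ∘ prev-next))

Σℕ-rotate : ∀ n r (h : Fin n → ℕ) → Σℕ n (h ∘ rotate r) ≡ Σℕ n h
Σℕ-rotate n zero    h = refl
Σℕ-rotate n (suc r) h = trans (Σℕ-rotate n r (h ∘ next)) (Σℕ-next n h)

next-of : ∀ {m} (u v : Fin (suc m)) → toℕ v ≡ suc (toℕ u) → v ≡ next u
next-of u v v≡u+1 with next-cases u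
... | inj₁ (_ , u+1) = toℕ-injective (trans v≡u+1 (sym u+1))
... | inj₂ (last , _) = ⊥-elim (<-irrefl (trans v≡u+1 (cong suc last)) (toℕ<n v))

next-of-last : ∀ {m} (u v : Fin (suc m)) → toℕ u ≡ m → toℕ v ≡ 0 → v ≡ next u
next-of-last u v last v≡0 with next-cases u
... | inj₁ (lt , _) = ⊥-elim (<-irrefl last lt)
... | inj₂ (_ , wrap) = toℕ-injective (trans v≡0 (cong toℕ (sym wrap)))

cycle-adjacent : ∀ {n} (u v : Fin n) → cycleGraph n u v ≡ true → v ≡ next u ⊎ u ≡ next v
cycle-adjacent {suc m} u v adj with Equivalence.to T-∨ (Equivalence.from T-≡ adj)
... | inj₁ v≡u+1 = inj₁ (next-of u v (≡ᵇ⇒≡ (toℕ v) (suc (toℕ u)) v≡u+1))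
... | inj₂ adj′ with Equivalence.to T-∨ adj′
...   | inj₁ u≡v+1 = inj₂ (next-of v u (≡ᵇ⇒≡ (toℕ u) (suc (toℕ v)) u≡v+1))
...   | inj₂ adj″ with Equivalence.to T-∨ adj″
...     | inj₁ wrap = let (u≡0 , v-last) = Equivalence.to T-∧ wrap in
          inj₂ (next-of-last v u (≡ᵇ⇒≡ (toℕ v) m v-last) (≡ᵇ⇒≡ (toℕ u) 0 u≡0))
...     | inj₂ wrap = let (v≡0 , u-last) = Equivalence.to T-∧ wrap in
          inj₁ (next-of-last u v (≡ᵇ⇒≡ (toℕ u) m u-last) (≡ᵇ⇒≡ (toℕ v) 0 v≡0))

-- The adjacency test of C_n read on vertex indices: cycleGraph n u v is
-- cycleAdj n (toℕ u) (toℕ v) by definition.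
cycleAdj : ℕ → ℕ → ℕ → Bool
cycleAdj n a b = (b ≡ᵇ suc a) ∨ (a ≡ᵇ suc b) ∨ ((a ≡ᵇ 0) ∧ (suc b ≡ᵇ n)) ∨ ((b ≡ᵇ 0) ∧ (suc a ≡ᵇ n))

cycleAdj-step : ∀ n a → cycleAdj n a (suc a) ≡ true × cycleAdj n (suc a) a ≡ true
cycleAdj-step n a rewrite ≡ᵇ-refl a = refl , ∨-zeroʳ (a ≡ᵇ suc (suc a))

cycleAdj-wrap : ∀ m → cycleAdj (suc m) m 0 ≡ true × cycleAdj (suc m) 0 m ≡ true
cycleAdj-wrap m rewrite ≡ᵇ-refl m = trans (cong ((m ≡ᵇ 1) ∨_) (∨-zeroʳ _)) (∨-zeroʳ _) , ∨-zeroʳ _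

cycle-edge : ∀ {n} (u : Fin n) → cycleGraph n u (next u) ≡ true × cycleGraph n (next u) u ≡ true
cycle-edge {suc m} u with next-cases u
... | inj₁ (_ , u+1) rewrite u+1 = cycleAdj-step (suc m) (toℕ u)
... | inj₂ (last , wrap) rewrite wrap =
  subst (λ a → cycleAdj (suc m) a 0 ≡ true × cycleAdj (suc m) 0 a ≡ true) (sym last) (cycleAdj-wrap m)

-- Whether a vertex of sign a is good, i.e. has closed out-sum at least 1, when its arc to
-- the successor (of sign c) is present iff b and its arc to the predecessor (of sign e)
-- is present iff ¬ d.
isGood : Bool → Bool → Bool → Bool → Bool → Bool
isGood a b c d e = does (+ 1 ℤP.≤? val a +ℤ ((if b then val c else + 0) +ℤ (if not d then val e else + 0)))

-- Goodness of u under f in the orientation of C_n with forward-edge pattern o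
-- (o u holds iff the edge {u, next u} is the arc u → next u).
good : ∀ {n} → (Fin n → Bool) → SignFun n → Fin n → Bool
good o f u = isGood (f u) (o u) (f (next u)) (o (prev u)) (f (prev u))

goodVertices : ∀ {n} → (Fin n → Bool) → SignFun n → ℕ
goodVertices {n} o f = Σℕ n (λ u → ind (good o f u))

good-cong : ∀ {n} {o o′ : Fin n → Bool} {f f′ : SignFun n} →
  (∀ u → o u ≡ o′ u) → (∀ u → f u ≡ f′ u) → ∀ u → good o f u ≡ good o′ f′ u
good-cong o≗o′ f≗f′ u rewrite o≗o′ u | o≗o′ (prev u) | f≗f′ u | f≗f′ (next u) | f≗f′ (prev u) = refl

goodVertices-cong : ∀ {n} {o o′ : Fin n → Bool} {f f′ : SignFun n} →
  (∀ u → o u ≡ o′ u) → (∀ u → f u ≡ f′ u) → goodVertices o f ≡ goodVertices o′ f′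
goodVertices-cong {n} o≗o′ f≗f′ = Σℕ-cong n (cong ind ∘ good-cong o≗o′ f≗f′)

goodVertices-rotate : ∀ {n} r (o : Fin n → Bool) (f : SignFun n) →
  goodVertices (o ∘ rotate r) (f ∘ rotate r) ≡ goodVertices o f
goodVertices-rotate {n} r o f = trans (Σℕ-cong n rotated) (Σℕ-rotate n r (λ u → ind (good o f u)))
  where
  rotated : ∀ j → ind (good (o ∘ rotate r) (f ∘ rotate r) j) ≡ ind (good o f (rotate r j))
  rotated j rewrite rotate-next r j | rotate-prev r j = refl

isGood-forward : ∀ d e → isGood true true true d e ≡ true
isGood-forward true  e     = refl
isGood-forward false true  = refl
isGood-forward false false = refl

isGood-backward : ∀ b c → isGood true b c false true ≡ true
isGood-backward true  true  = refl
isGood-backward true  false = refl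
isGood-backward false c     = refl

isGood-sink : ∀ c e → isGood true false c true e ≡ true
isGood-sink c e = refl

isGood-closed : ∀ b d → isGood true b true d true ≡ true
isGood-closed true  d     = isGood-forward d true
isGood-closed false true  = isGood-sink true true
isGood-closed false false = isGood-backward false true

-- A -1 vertex is good exactly when it is a source whose two neighbours are +1 vertices.
isGood-minus : ∀ b c d e → isGood false b c d e ≡ b ∧ c ∧ not d ∧ e
isGood-minus true  true  true  e     = refl
isGood-minus true  true  false true  = refl
isGood-minus true  true  false false = refl
isGood-minus true  false true  e     = refl
isGood-minus true  false false true  = refl
isGood-minus true  false false false = refl
isGood-minus false c     true  e     = refl
isGood-minus false c     false true  = refl
isGood-minus false c     false false = refl

good-from : ∀ {n} (o : Fin n → Bool) (f : SignFun n) u {a b c d e} →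
  f u ≡ a → o u ≡ b → f (next u) ≡ c → o (prev u) ≡ d → f (prev u) ≡ e →
  isGood a b c d e ≡ true → good o f u ≡ true
good-from o f u refl refl refl refl refl isgood = isgood

isGood-directed : ∀ a c e → isGood a true c true e ≡ a ∧ c
isGood-directed true  true  e     = isGood-forward true e
isGood-directed true  false e     = refl
isGood-directed false c     e     = trans (isGood-minus true c true e) (∧-zeroʳ c)

∧-shape : ∀ b c d e → b ∧ c ∧ not d ∧ e ≡ true → b ≡ true × c ≡ true × d ≡ false × e ≡ true
∧-shape true  true  false true  _ = refl , refl , refl , refl
∧-shape true  true  false false ()
∧-shape true  true  true  _     ()
∧-shape true  false _     _     ()
∧-shape false _     _     _     ()

good-minus : ∀ {n} (o : Fin n → Bool) (f : SignFun n) u → not (f u) ∧ good o f u ≡ true →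
  f u ≡ false × f (next u) ≡ true × f (prev u) ≡ true
good-minus o f u good-1 = minus , proj₁ (proj₂ parts) , proj₂ (proj₂ (proj₂ parts))
  where
  minus : f u ≡ false
  minus = trans (sym (not-involutive _)) (cong not (∧-conicalˡ _ _ good-1))
  parts = ∧-shape (o u) (f (next u)) (o (prev u)) (f (prev u))
            (trans (sym (isGood-minus (o u) (f (next u)) (o (prev u)) (f (prev u))))
                   (subst (λ a → isGood a (o u) (f (next u)) (o (prev u)) (f (prev u)) ≡ true)
                          minus (∧-conicalʳ _ _ good-1)))

forward : ∀ {n} → Digraph n → Fin n → Bool
forward D u = D u (next u)

orient : ∀ {n} → (Fin n → Bool) → Digraph n
orient o u v = (does (v ≟ᶠ next u) ∧ o u) ∨ (does (u ≟ᶠ next v) ∧ not (o v))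

module _ {n} (n≥3 : 3 ≤ n) (o : Fin n → Bool) where

  orient-forward : ∀ u → orient o u (next u) ≡ o u
  orient-forward u
    rewrite dec-true (next u ≟ᶠ next u) refl | dec-false (u ≟ᶠ next (next u)) (next-next≢ n≥3 u ∘ sym)
    = ∨-identityʳ (o u)

  orient-backward : ∀ u → orient o (next u) u ≡ not (o u)
  orient-backward u
    rewrite dec-true (next u ≟ᶠ next u) refl | dec-false (u ≟ᶠ next (next u)) (next-next≢ n≥3 u ∘ sym)
    = refl

  orient-isOrientation : IsOrientation n (cycleGraph n) (orient o)
  orient-isOrientation = arcs-are-edges , edges-are-oriented
    where
    arcs-are-edges : ∀ u v → orient o u v ≡ true → cycleGraph n u v ≡ true
    arcs-are-edges u v arc with v ≟ᶠ next u | u ≟ᶠ next v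
    ... | yes refl | _        = proj₁ (cycle-edge u)
    ... | no _     | yes refl = proj₂ (cycle-edge v)
    arcs-are-edges u v () | no _ | no _
    one-way : ∀ {a b} x → a ≡ x → b ≡ not x → (a ≡ true × b ≡ false) ⊎ (a ≡ false × b ≡ true)
    one-way true  refl refl = inj₁ (refl , refl)
    one-way false refl refl = inj₂ (refl , refl)
    edges-are-oriented : ∀ u v → cycleGraph n u v ≡ true →
      (orient o u v ≡ true × orient o v u ≡ false) ⊎ (orient o u v ≡ false × orient o v u ≡ true)
    edges-are-oriented u v edge with cycle-adjacent u v edge
    ... | inj₁ refl = one-way (o u) (orient-forward u) (orient-backward u)
    ... | inj₂ refl = one-way (not (o v)) (orient-backward v) (trans (orient-forward v) (sym (not-involutive _)))

module _ {n} {D : Digraph n} (ori : IsOrientation n (cycleGraph n) D) where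

  out-neighbour : ∀ u v → D u v ≡ true → v ≡ next u ⊎ v ≡ prev u
  out-neighbour u v arc with cycle-adjacent u v (proj₁ ori u v arc)
  ... | inj₁ v≡next = inj₁ v≡next
  ... | inj₂ u≡next = inj₂ (trans (sym (prev-next v)) (cong prev (sym u≡next)))

  arc-to-prev : ∀ u → D u (prev u) ≡ not (forward D (prev u))
  arc-to-prev u = subst (λ w → D w (prev u) ≡ not (forward D (prev u))) (next-prev u)
                    (reverse-arc (proj₂ ori (prev u) (next (prev u)) (proj₁ (cycle-edge (prev u)))))
    where
    reverse-arc : ∀ {a b} → (a ≡ true × b ≡ false) ⊎ (a ≡ false × b ≡ true) → b ≡ not a
    reverse-arc (inj₁ (refl , refl)) = refl
    reverse-arc (inj₂ (refl , refl)) = refl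

  closedOutSum-local : 3 ≤ n → ∀ f u → closedOutSum n D f u ≡
    val (f u) +ℤ ((if forward D u then val (f (next u)) else + 0)
                 +ℤ (if not (forward D (prev u)) then val (f (prev u)) else + 0))
  closedOutSum-local n≥3 f u = cong (val (f u) +ℤ_) (begin
    Σℤ n arcTerm                                                 ≡⟨ Σℤ-cong n split ⟩
    Σℤ n (λ v → at (next u) v +ℤ at (prev u) v)                  ≡⟨ Σℤ-+ n (at (next u)) (at (prev u)) ⟩
    Σℤ n (at (next u)) +ℤ Σℤ n (at (prev u))                      ≡⟨ cong₂ _+ℤ_ (Σℤ-single n (next u) _)
                                                                                (Σℤ-single n (prev u) _) ⟩
    arcTerm (next u) +ℤ arcTerm (prev u)                          ≡⟨ cong (λ b → arcTerm (next u) +ℤ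
                                                                       (if b then val (f (prev u)) else + 0))
                                                                       (arc-to-prev u) ⟩
    arcTerm (next u) +ℤ (if not (forward D (prev u)) then val (f (prev u)) else + 0) ∎)
    where
    open ≡-Reasoning
    arcTerm : Fin n → ℤ
    arcTerm v = if D u v then val (f v) else + 0
    at : Fin n → Fin n → ℤ
    at w v = if does (v ≟ᶠ w) then arcTerm w else + 0
    split : ∀ v → arcTerm v ≡ at (next u) v +ℤ at (prev u) v
    split v with v ≟ᶠ next u | v ≟ᶠ prev u
    ... | yes refl | yes v≡prev = ⊥-elim (next≢prev n≥3 u v≡prev)
    ... | yes refl | no _       = sym (ℤP.+-identityʳ _)
    ... | no _     | yes refl   = sym (ℤP.+-identityˡ _)
    ... | no v≢next | no v≢prev with D u v in arc
    ...   | false = refl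
    ...   | true  = ⊥-elim ([ v≢next , v≢prev ] (out-neighbour u v arc))

  goodCount-local : 3 ≤ n → ∀ f → goodCount n D f ≡ goodVertices (forward D) f
  goodCount-local n≥3 f = Σℕ-cong n λ u →
    cong (λ s → ind (does (+ 1 ℤP.≤? s))) (closedOutSum-local n≥3 f u)

weight-positives : ∀ n (f : SignFun n) → weight n f ≡ - (+ n) +ℤ + (2 * positives n f)
weight-positives zero    f = refl
weight-positives (suc n) f with f zero | weight-positives n (f ∘ suc)
... | true  | ih = begin
  + 1 +ℤ weight n (f ∘ suc)               ≡⟨ cong (+ 1 +ℤ_) ih ⟩
  + 1 +ℤ (- (+ n) +ℤ + (2 * p))            ≡⟨ plus-step (+ n) (+ (2 * p)) ⟩
  - (+ suc n) +ℤ (+ 2 +ℤ + (2 * p))        ≡⟨ cong (λ k → - (+ suc n) +ℤ + k) (sym (*-suc 2 p)) ⟩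
  - (+ suc n) +ℤ + (2 * suc p)             ∎
  where
  open ≡-Reasoning
  p = positives n (f ∘ suc)
  plus-step : ∀ N P → + 1 +ℤ (- N +ℤ P) ≡ - (+ 1 +ℤ N) +ℤ (+ 2 +ℤ P)
  plus-step = ℤSolver.solve-∀
... | false | ih = trans (cong (- (+ 1) +ℤ_) ih) (minus-step (+ n) (+ (2 * positives n (f ∘ suc))))
  where
  minus-step : ∀ N P → - (+ 1) +ℤ (- N +ℤ P) ≡ - (+ 1 +ℤ N) +ℤ P
  minus-step = ℤSolver.solve-∀

-- Lower bound for every orientation: a MODF has at least ⌈(n+2)/4⌉ positive vertices

module _ {n} (o : Fin n → Bool) (f : SignFun n) where

  goodPlus goodMinus : Fin n → ℕ
  goodPlus  u = ind (f u ∧ good o f u)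
  goodMinus u = ind (not (f u) ∧ good o f u)

  good-split : ∀ u → ind (good o f u) ≡ goodPlus u + goodMinus u
  good-split u with f u | good o f u
  ... | true  | b     = sym (+-identityʳ (ind b))
  ... | false | _     = refl

  -- Each good -1 vertex is charged to its successor, which is a +1 vertex.
  charge : Fin n → ℕ
  charge j = goodPlus j + goodMinus (prev j)

  good≡Σcharge : goodVertices o f ≡ Σℕ n charge
  good≡Σcharge = begin
    goodVertices o f                            ≡⟨ Σℕ-cong n good-split ⟩
    Σℕ n (λ u → goodPlus u + goodMinus u)       ≡⟨ Σℕ-+ n goodPlus goodMinus ⟩
    Σℕ n goodPlus + Σℕ n goodMinus              ≡⟨ cong (λ s → Σℕ n goodPlus + s) (sym (Σℕ-prev n goodMinus)) ⟩
    Σℕ n goodPlus + Σℕ n (goodMinus ∘ prev)     ≡⟨ sym (Σℕ-+ n goodPlus (goodMinus ∘ prev)) ⟩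
    Σℕ n charge                                 ∎
    where open ≡-Reasoning

  good-minus-prev : ∀ j → not (f (prev j)) ∧ good o f (prev j) ≡ true → f j ≡ true
  good-minus-prev j good-1 =
    subst (λ w → f w ≡ true) (next-prev j) (proj₁ (proj₂ (good-minus o f (prev j) good-1)))

  goodMinus-prev≤ : ∀ j → goodMinus (prev j) ≤ ind (f j)
  goodMinus-prev≤ j with not (f (prev j)) ∧ good o f (prev j) in gm
  ... | false = z≤n
  ... | true  = ≤-reflexive (cong ind (sym (good-minus-prev j gm)))

  goodPlus≤ : ∀ j → goodPlus j ≤ ind (f j)
  goodPlus≤ j = ind-∧≤ (f j) (good o f j)

  charge≤ : ∀ j → charge j ≤ ind (f j) + ind (f j)
  charge≤ j = +-mono-≤ (goodPlus≤ j) (goodMinus-prev≤ j)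

  tight-step : (∀ j → charge j ≡ ind (f j) + ind (f j)) → ∀ j → f j ≡ true →
    f (prev j) ≡ false × f (prev (prev j)) ≡ true
  tight-step tight j fj = proj₁ parts , proj₂ (proj₂ parts)
    where
    good-1 : not (f (prev j)) ∧ good o f (prev j) ≡ true
    good-1 = ind≡1 (trans (second-maximal (goodPlus≤ j) (goodMinus-prev≤ j) (tight j)) (cong ind fj))
    parts = good-minus o f (prev j) good-1

  tight-alternating : (∀ j → charge j ≡ ind (f j) + ind (f j)) → ∀ {j} → f j ≡ true →
    ∀ i → f i ≡ not (f (prev i))
  tight-alternating tight {j} fj = propagate-prev Alternates step (start j fj)
    where
    Alternates : Fin n → Set
    Alternates i = f i ≡ not (f (prev i))
    start : ∀ i → f i ≡ true → Alternates i
    start i fi = trans fi (cong not (sym (proj₁ (tight-step tight i fi))))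
    step : ∀ i → Alternates i → Alternates (prev i)
    step i alt with f i in fi
    ... | true  = trans (proj₁ (tight-step tight i fi)) (cong not (sym (proj₂ (tight-step tight i fi))))
    ... | false = start (prev i) (trans (sym (not-involutive _)) (cong not (sym alt)))

  alternating-half : (∀ i → f i ≡ not (f (prev i))) → positives n f + positives n f ≡ n
  alternating-half alt = begin
    positives n f + positives n f                   ≡⟨ cong (λ s → positives n f + s) (sym (Σℕ-prev n (ind ∘ f))) ⟩
    Σℕ n (ind ∘ f) + Σℕ n (ind ∘ f ∘ prev)          ≡⟨ sym (Σℕ-+ n (ind ∘ f) (ind ∘ f ∘ prev)) ⟩
    Σℕ n (λ i → ind (f i) + ind (f (prev i)))       ≡⟨ Σℕ-cong n one-of-two ⟩
    Σℕ n (λ _ → 1)                                  ≡⟨ Σℕ-one n ⟩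
    n                                               ∎
    where
    open ≡-Reasoning
    one-of-two : ∀ i → ind (f i) + ind (f (prev i)) ≡ 1
    one-of-two i rewrite alt i with f (prev i)
    ... | true  = refl
    ... | false = refl

  -- With slack in some charge, #good ≤ 2p - 1, and 2·#good ≥ n gives 4p ≥ n + 2.
  slack-positives : suc (Σℕ n charge) ≤ Σℕ n (λ j → ind (f j) + ind (f j)) →
    n ≤ 2 * goodVertices o f → n + 2 ≤ 4 * positives n f
  slack-positives slack half = begin
    n + 2                                      ≤⟨ +-monoˡ-≤ 2 half ⟩
    2 * goodVertices o f + 2                   ≡⟨ cong (λ s → 2 * s + 2) good≡Σcharge ⟩
    2 * Σℕ n charge + 2                        ≡⟨ double-suc (Σℕ n charge) ⟩
    2 * suc (Σℕ n charge)                      ≤⟨ *-monoʳ-≤ 2 slack ⟩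
    2 * Σℕ n (λ j → ind (f j) + ind (f j))     ≡⟨ cong (2 *_) (Σℕ-+ n (ind ∘ f) (ind ∘ f)) ⟩
    2 * (positives n f + positives n f)        ≡⟨ quadruple (positives n f) ⟩
    4 * positives n f                          ∎
    where
    open ≤-Reasoning
    double-suc : ∀ x → 2 * x + 2 ≡ 2 * suc x
    double-suc = ℕSolver.solve-∀
    quadruple : ∀ p → 2 * (p + p) ≡ 4 * p
    quadruple = ℕSolver.solve-∀

  -- Without slack the signs alternate, so 2p = n ≥ 2; and some vertex is positive, as
  -- otherwise no vertex would be good.
  tight-positives : (∀ j → charge j ≡ ind (f j) + ind (f j)) → 2 ≤ n →
    n ≤ 2 * goodVertices o f → n + 2 ≤ 4 * positives n f
  tight-positives tight n≥2 half with positive-or-none n f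
  ... | inj₁ (j , fj) = begin
    n + 2                                      ≤⟨ +-monoʳ-≤ n n≥2 ⟩
    n + n                                      ≡⟨ cong₂ _+_ half-positive half-positive ⟩
    (p + p) + (p + p)                          ≡⟨ quadruple p ⟩
    4 * p                                      ∎
    where
    open ≤-Reasoning
    p = positives n f
    half-positive : n ≡ p + p
    half-positive = sym (alternating-half (tight-alternating tight fj))
    quadruple : ∀ p → (p + p) + (p + p) ≡ 4 * p
    quadruple = ℕSolver.solve-∀
  ... | inj₂ none = ⊥-elim (n≮0 (≤-trans n≥2 (≤-trans half (≤-reflexive (cong (2 *_) nothing-good)))))
    where
    open ≡-Reasoning
    nothing-good : goodVertices o f ≡ 0
    nothing-good = begin
      goodVertices o f                         ≡⟨ good≡Σcharge ⟩
      Σℕ n charge                              ≡⟨ Σℕ-cong n tight ⟩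
      Σℕ n (λ j → ind (f j) + ind (f j))       ≡⟨ Σℕ-+ n (ind ∘ f) (ind ∘ f) ⟩
      positives n f + positives n f            ≡⟨ cong₂ _+_ (no-positives n none) (no-positives n none) ⟩
      0                                        ∎

  modf-positives : 2 ≤ n → n ≤ 2 * goodVertices o f → n + 2 ≤ 4 * positives n f
  modf-positives n≥2 half with Σℕ-strict-or-equal n charge≤
  ... | inj₁ slack = slack-positives slack half
  ... | inj₂ tight = tight-positives tight n≥2 half

directed-positives : ∀ {n} → 1 ≤ n → (f : SignFun n) → n ≤ 2 * goodVertices (λ _ → true) f →
  n + 2 ≤ 2 * positives n f ⊎ positives n f ≡ n
directed-positives {n} n≥1 f half with Σℕ-strict-or-equal n good≤positive
  where
  good≤positive : ∀ j → ind (good (λ _ → true) f j) ≤ ind (f j)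
  good≤positive j rewrite isGood-directed (f j) (f (next j)) (f (prev j)) = ind-∧≤ (f j) (f (next j))
... | inj₁ slack = inj₁ (begin
  n + 2                                           ≤⟨ +-monoˡ-≤ 2 half ⟩
  2 * goodVertices (λ _ → true) f + 2              ≡⟨ double-suc (goodVertices (λ _ → true) f) ⟩
  2 * suc (goodVertices (λ _ → true) f)            ≤⟨ *-monoʳ-≤ 2 slack ⟩
  2 * positives n f                               ∎)
  where
  open ≤-Reasoning
  double-suc : ∀ x → 2 * x + 2 ≡ 2 * suc x
  double-suc = ℕSolver.solve-∀
... | inj₂ tight with positive-or-none n f
...   | inj₁ (j , fj) = inj₂ (trans (Σℕ-cong n (λ i → cong ind (all-positive i))) (Σℕ-one n))
  where
  step : ∀ i → f i ≡ true → f (next i) ≡ true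
  step i fi = ∧-conicalʳ (f i) _ (trans (sym (isGood-directed (f i) (f (next i)) (f (prev i))))
                                        (ind≡1 (trans (tight i) (cong ind fi))))
  all-positive : ∀ i → f i ≡ true
  all-positive = propagate-next (λ i → f i ≡ true) step fj
...   | inj₂ none = ⊥-elim (n≮0 (≤-trans n≥1 (≤-trans half (≤-reflexive (cong (2 *_) nothing-good)))))
  where
  nothing-good : goodVertices (λ _ → true) f ≡ 0
  nothing-good = trans (Σℕ-cong n tight) (no-positives n none)

-- Good sign functions for every orientation: a window of consecutive +1 vertices

window : ∀ {m} → ℕ → SignFun (suc m)
window K j = toℕ j <ᵇ suc K

module _ {m} (K : ℕ) (o : Fin (suc m) → Bool) where

  private
    W : SignFun (suc m)
    W = window K


  window-inside : ∀ j → toℕ j ≤ K → W j ≡ true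
  window-inside j j≤K = <ᵇ-true (s≤s j≤K)

  window-next : ∀ j → toℕ j < K → W (next j) ≡ true
  window-next j j<K = window-inside (next j) (≤-trans (toℕ-next≤ j) j<K)

  -- If the edge {0, 1} points forward, the vertices 0, …, K-1 are good: vertex 0 has
  -- an arc to the +1 vertex 1, the others have only +1 neighbours.
  window-good-forward : o zero ≡ true → ∀ j → (toℕ j <ᵇ K) ≡ true → good o W j ≡ true
  window-good-forward o0 zero 0<K =
    good-from o W zero refl o0 (window-next zero (<ᵇ-sound 0<K)) refl refl
      (isGood-forward (o (prev zero)) (W (prev zero)))
  window-good-forward o0 (suc j) j+1<K =
    good-from o W (suc j) (window-inside (suc j) (<⇒≤ (<ᵇ-sound j+1<K))) refl
      (window-next (suc j) (<ᵇ-sound j+1<K)) refl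
      (window-inside (inject₁ j) (subst (_≤ K) (sym (toℕ-inject₁ j)) (≤-trans (n≤1+n _) (<⇒≤ (<ᵇ-sound j+1<K)))))
      (isGood-closed (o (suc j)) (o (inject₁ j)))

  -- If all edges point backward, the vertices 1, …, K are good: each has an arc to its
  -- +1 predecessor.
  window-good-backward : (∀ j → o j ≡ false) → ∀ (j : Fin m) → (toℕ j <ᵇ K) ≡ true →
    good o W (suc j) ≡ true
  window-good-backward backward j j<K =
    good-from o W (suc j) (window-inside (suc j) (<ᵇ-sound j<K)) refl refl (backward (inject₁ j))
      (window-inside (inject₁ j) (subst (_≤ K) (sym (toℕ-inject₁ j)) (<⇒≤ (<ᵇ-sound j<K))))
      (isGood-backward (o (suc j)) (W (next (suc j))))

  window-count-forward : o zero ≡ true → K ≤ suc m → K ≤ goodVertices o W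
  window-count-forward o0 K≤n = begin
    K                                       ≡⟨ count-below (suc m) K K≤n ⟨
    Σℕ (suc m) (λ j → ind (toℕ j <ᵇ K))     ≤⟨ count-mono (suc m) (window-good-forward o0) ⟩
    goodVertices o W                         ∎
    where open ≤-Reasoning

  window-count-backward : (∀ j → o j ≡ false) → K ≤ m → K ≤ goodVertices o W
  window-count-backward backward K≤m = begin
    K                                       ≡⟨ count-below m K K≤m ⟨
    Σℕ m (λ j → ind (toℕ j <ᵇ K))           ≤⟨ count-mono m (window-good-backward backward) ⟩
    Σℕ m (λ j → ind (good o W (suc j)))     ≤⟨ m≤n+m _ _ ⟩
    goodVertices o W                         ∎
    where open ≤-Reasoning

window-positives : ∀ {m} K → K < suc m → positives (suc m) (window K) ≡ suc K
window-positives {m} K K<n = count-below (suc m) (suc K) K<n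

-- Every orientation of C_n has, for K < n, a sign function with K + 1 positive vertices
-- and at least K good vertices: a window of K + 1 consecutive +1 vertices, rotated so
-- that the edge at its start points into it (or, if all edges point backward, unrotated).
window-modf : ∀ {m} (o : Fin (suc m) → Bool) K → K < suc m →
  Σ (SignFun (suc m)) λ f → K ≤ goodVertices o f × positives (suc m) f ≡ suc K
window-modf {m} o K K<n with positive-or-none (suc m) o
... | inj₂ backward = window K , window-count-backward K o backward (≤-pred K<n) , window-positives K K<n
... | inj₁ (k , ok) = window K ∘ unrotate r , count , positives-eq
  where
  r = toℕ k
  o′ : Fin (suc m) → Bool
  o′ = o ∘ rotate r
  f : SignFun (suc m)
  f = window K ∘ unrotate r
  unrotated : ∀ j → f (rotate r j) ≡ window K j
  unrotated j = cong (window K) (unrotate-rotate r j)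
  count : K ≤ goodVertices o f
  count = begin
    K                                     ≤⟨ window-count-forward K o′ (trans (cong o (rotate-from-zero k)) ok) (<⇒≤ K<n) ⟩
    goodVertices o′ (window K)             ≡⟨ goodVertices-cong {o = o′} (λ _ → refl) unrotated ⟨
    goodVertices o′ (f ∘ rotate r)         ≡⟨ goodVertices-rotate r o f ⟩
    goodVertices o f                       ∎
    where open ≤-Reasoning
  positives-eq : positives (suc m) f ≡ suc K
  positives-eq = begin
    positives (suc m) f                   ≡⟨ Σℕ-rotate (suc m) r (ind ∘ f) ⟨
    Σℕ (suc m) (ind ∘ f ∘ rotate r)       ≡⟨ Σℕ-cong (suc m) (cong ind ∘ unrotated) ⟩
    positives (suc m) (window K)          ≡⟨ window-positives K K<n ⟩
    suc K                                 ∎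
    where open ≡-Reasoning

-- A good sign function with few positive vertices: alternating signs on a window

even : ℕ → Bool
even zero          = true
even (suc zero)    = false
even (suc (suc k)) = even k

even-suc : ∀ k → even (suc k) ≡ not (even k)
even-suc zero          = refl
even-suc (suc zero)    = refl
even-suc (suc (suc k)) = even-suc k

even-double : ∀ q → even (q + q) ≡ true
even-double zero    = refl
even-double (suc q) rewrite +-suc q q = even-double q

alternating : ∀ {m} → ℕ → SignFun (suc m)
alternating q j = (toℕ j <ᵇ suc (q + q)) ∧ even (toℕ j)

alternating-positives : ∀ n q → suc (q + q) ≤ n →
  Σℕ n (λ j → ind ((toℕ j <ᵇ suc (q + q)) ∧ even (toℕ j))) ≡ suc q
alternating-positives (suc n)       zero    _ = cong suc (Σℕ-zero n)
alternating-positives (suc (suc n)) (suc q) (s≤s (s≤s 2q+1≤n)) rewrite +-suc q q =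
  cong suc (alternating-positives n q 2q+1≤n)

-- In the orientation not ∘ f every edge between a +1 and a -1 vertex points towards the
-- +1 vertex. Then every +1 vertex is good, since its out-arcs lead to +1 vertices, …
receiving-good : ∀ {n} (f : SignFun n) u → f u ≡ true → good (not ∘ f) f u ≡ true
receiving-good f u fu = good-from (not ∘ f) f u fu (cong not fu) refl refl refl (receiving (f (next u)) (f (prev u)))
  where
  receiving : ∀ c e → isGood true false c (not e) e ≡ true
  receiving c true  = isGood-backward false c
  receiving c false = isGood-sink c false

-- … and a -1 vertex between two +1 vertices is good, being a source.
source-good : ∀ {n} (f : SignFun n) u → f u ≡ false → f (next u) ≡ true → f (prev u) ≡ true →
  good (not ∘ f) f u ≡ true
source-good f u fu fn fp = good-from (not ∘ f) f u fu (cong not fu) fn (cong not fp) fp refl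

module _ {m} (q : ℕ) (2q+1≤n : suc (q + q) ≤ suc m) where

  private
    A : SignFun (suc m)
    A = alternating q

  even-good : ∀ j → (toℕ j <ᵇ suc (q + q)) ≡ true → even (toℕ j) ≡ true → good (not ∘ A) A j ≡ true
  even-good j j<2q+1 parity = receiving-good A j (cong₂ _∧_ j<2q+1 parity)

  odd-good : ∀ j → (toℕ j <ᵇ suc (q + q)) ≡ true → even (toℕ j) ≡ false → good (not ∘ A) A j ≡ true
  odd-good (suc j) j<ᵇ2q+1 parity =
    source-good A (suc j) (trans (cong (in-window ∧_) parity) (∧-zeroʳ in-window)) next-positive prev-positive
    where
    in-window : Bool
    in-window = suc (toℕ j) <ᵇ suc (q + q)
    j<2q+1 : suc (toℕ j) < suc (q + q)
    j<2q+1 = <ᵇ-sound {suc (toℕ j)} j<ᵇ2q+1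
    even-j : even (toℕ j) ≡ true
    even-j = trans (sym (not-involutive _)) (cong not (trans (sym (even-suc (toℕ j))) parity))
    prev-positive : A (inject₁ j) ≡ true
    prev-positive rewrite toℕ-inject₁ j = cong₂ _∧_ (<ᵇ-true (<-trans (n<1+n _) j<2q+1)) even-j
    j+2≢2q+1 : suc (suc (toℕ j)) ≢ suc (q + q)
    j+2≢2q+1 eq = false≢true (begin
      false               ≡⟨ cong not even-j ⟨
      not (even (toℕ j))  ≡⟨ even-suc (toℕ j) ⟨
      even (suc (toℕ j))  ≡⟨ cong even (suc-injective eq) ⟩
      even (q + q)        ≡⟨ even-double q ⟩
      true                ∎)
      where open ≡-Reasoning
            false≢true : false ≢ true
            false≢true ()
    next-positive : A (next (suc j)) ≡ true
    next-positive with next (suc j) | next-cases (suc j)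
    ... | _ | inj₂ (_ , refl) = refl
    ... | k | inj₁ (_ , k≡j+2) rewrite k≡j+2 =
      cong₂ _∧_ (<ᵇ-true (≤∧≢⇒< j<2q+1 j+2≢2q+1)) even-j

  alternating-good : ∀ j → (toℕ j <ᵇ suc (q + q)) ≡ true → good (not ∘ A) A j ≡ true
  alternating-good j j<2q+1 with even (toℕ j) ≟ᵇ true
  ... | yes parity = even-good j j<2q+1 parity
  ... | no  parity = odd-good j j<2q+1 (¬-not parity)

  alternating-count : suc (q + q) ≤ goodVertices (not ∘ A) A
  alternating-count = begin
    suc (q + q)                                      ≡⟨ count-below (suc m) (suc (q + q)) 2q+1≤n ⟨
    Σℕ (suc m) (λ j → ind (toℕ j <ᵇ suc (q + q)))    ≤⟨ count-mono (suc m) alternating-good ⟩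
    goodVertices (not ∘ A) A                          ∎
    where open ≤-Reasoning

-- c = (n + 5) / 4 = ⌈(n + 2) / 4⌉ is the least c with n + 2 ≤ 4c.
ceil-bound : ∀ n → n + 2 ≤ 4 * ((n + 5) / 4)
ceil-bound n = +-cancelʳ-≤ 3 (n + 2) (4 * c) (begin
  n + 2 + 3          ≡⟨ +-assoc n 2 3 ⟩
  n + 5              ≡⟨ m≡m%n+[m/n]*n (n + 5) 4 ⟩
  (n + 5) % 4 + c * 4 ≤⟨ +-monoˡ-≤ (c * 4) (≤-pred (m%n<n (n + 5) 4)) ⟩
  3 + c * 4          ≡⟨ +-comm 3 (c * 4) ⟩
  c * 4 + 3          ≡⟨ cong (λ x → x + 3) (*-comm c 4) ⟩
  4 * c + 3          ∎)
  where
  open ≤-Reasoning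
  c = (n + 5) / 4

ceil-least : ∀ n c → n + 2 ≤ 4 * c → (n + 5) / 4 ≤ c
ceil-least n c n+2≤4c = ≤-pred (m<n*o⇒m/o<n (begin-strict
  n + 5              ≡⟨ +-assoc n 2 3 ⟨
  n + 2 + 3          ≤⟨ +-monoˡ-≤ 3 n+2≤4c ⟩
  4 * c + 3          <⟨ +-monoʳ-< (4 * c) (n<1+n 3) ⟩
  4 * c + 4          ≡⟨ four-succ c ⟩
  suc c * 4          ∎))
  where
  open ≤-Reasoning
  four-succ : ∀ c → 4 * c + 4 ≡ suc c * 4
  four-succ = ℕSolver.solve-∀

ceil-window : ∀ n → 3 ≤ n → ∃ λ q → (n + 5) / 4 ≡ suc q × suc (q + q) ≤ n × n ≤ 2 * suc (q + q)
ceil-window n n≥3 with (n + 5) / 4 | ceil-bound n | m/n*n≤m (n + 5) 4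
... | zero  | n+2≤0 | _ = ⊥-elim (n≮0 (m+n≤o⇒n≤o n n+2≤0))
... | suc q | n+2≤4c | 4c≤n+5 = q , refl , window-fits , window-half
  where
  open ≤-Reasoning
  four-succ : ∀ q → 4 * suc q ≡ 2 * suc (q + q) + 2
  four-succ = ℕSolver.solve-∀
  window-half : n ≤ 2 * suc (q + q)
  window-half = +-cancelʳ-≤ 2 n _ (≤-trans n+2≤4c (≤-reflexive (four-succ q)))
  window-fits : suc (q + q) ≤ n
  window-fits = *-cancelˡ-≤ 2 (begin
    2 * suc (q + q)                 ≤⟨ +-cancelʳ-≤ 2 _ (n + 3) (begin
                                         2 * suc (q + q) + 2   ≡⟨ four-succ q ⟨
                                         4 * suc q             ≡⟨ *-comm 4 (suc q) ⟩
                                         suc q * 4             ≤⟨ 4c≤n+5 ⟩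
                                         n + 5                 ≡⟨ +-assoc n 3 2 ⟨
                                         n + 3 + 2             ∎) ⟩
    n + 3                           ≤⟨ +-monoʳ-≤ n n≥3 ⟩
    n + n                           ≡⟨ cong (λ x → n + x) (+-identityʳ n) ⟨
    2 * n                           ∎)

weight-exact : ∀ n t → - (+ n) +ℤ + (n + t) ≡ + t
weight-exact n t = cancel (+ n) (+ t)
  where
  cancel : ∀ N T → - N +ℤ (N +ℤ T) ≡ T
  cancel = ℤSolver.solve-∀

weight-mono : ∀ n {p p′} → p ≤ p′ → - (+ n) +ℤ + (2 * p) ≤ℤ - (+ n) +ℤ + (2 * p′)
weight-mono n p≤p′ = ℤP.+-monoʳ-≤ (- (+ n)) (ℤ.+≤+ (*-monoʳ-≤ 2 p≤p′))

weight-lower : ∀ n t p → n + t ≤ 2 * p → + t ≤ℤ - (+ n) +ℤ + (2 * p)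
weight-lower n t p n+t≤2p =
  subst (_≤ℤ - (+ n) +ℤ + (2 * p)) (weight-exact n t) (ℤP.+-monoʳ-≤ (- (+ n)) (ℤ.+≤+ n+t≤2p))

module _ {n} {G : Graph n} {k : ℤ} where

  isDomMaj-intro :
    (∀ D → IsOrientation n G D → ∀ f → IsMODF n D f → k ≤ℤ weight n f) →
    Σ (Digraph n) (λ D → IsOrientation n G D × Σ (SignFun n) λ f → IsMODF n D f × weight n f ≡ k) →
    IsDomMaj n G k
  isDomMaj-intro lower (D , ori , witness) =
      (D , ori , witness , lower D ori)
    , λ D′ ori′ j ((f , modf , wf≡j) , _) → subst (k ≤ℤ_) wf≡j (lower D′ ori′ f modf)

  isDOMMaj-intro :
    (∀ D → IsOrientation n G D → Σ (SignFun n) λ f → IsMODF n D f × weight n f ≡ k) →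
    (D₀ : Digraph n) → IsOrientation n G D₀ → (∀ f → IsMODF n D₀ f → k ≤ℤ weight n f) →
    IsDOMMaj n G k
  isDOMMaj-intro witness D₀ ori₀ lower =
      (D₀ , ori₀ , witness D₀ ori₀ , lower)
    , λ D ori j (_ , minimal) → let (f , modf , wf≡k) = witness D ori in
                                subst (j ≤ℤ_) wf≡k (minimal f modf)

n+t≤2n : ∀ {n t} → t ≤ n → n + t ≤ 2 * n
n+t≤2n {n} t≤n = ≤-trans (+-monoʳ-≤ n t≤n) (≤-reflexive (cong (λ x → n + x) (sym (+-identityʳ n))))

odd-improve : ∀ k p → suc (k * 2) + 2 ≤ 2 * p → suc (k * 2) + 3 ≤ 2 * p
odd-improve k p le = begin
  suc (k * 2) + 3       ≡⟨ identity₂ k ⟩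
  2 * suc (suc k)       ≤⟨ *-monoʳ-≤ 2 (*-cancelˡ-< 2 (suc k) p (≤-trans (≤-reflexive (identity₁ k)) le)) ⟩
  2 * p                 ∎
  where
  open ≤-Reasoning
  identity₁ : ∀ k → suc (2 * suc k) ≡ suc (k * 2) + 2
  identity₁ = ℕSolver.solve-∀
  identity₂ : ∀ k → suc (k * 2) + 3 ≡ 2 * suc (suc k)
  identity₂ = ℕSolver.solve-∀

odd-form : ∀ n → ¬ 2 ∣ n → ∃ λ k → n ≡ suc (k * 2)
odd-form n n-odd with n % 2 | m≡m%n+[m/n]*n n 2 | m%n<n n 2
... | 0           | n≡2k   | _ = ⊥-elim (n-odd (divides (n / 2) n≡2k))
... | 1           | n≡2k+1 | _ = n / 2 , n≡2k+1
... | suc (suc _) | _      | s≤s (s≤s ())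

module _ {m : ℕ} (n≥3 : 3 ≤ suc m) where

  private
    n : ℕ
    n = suc m

  dom-lower : ∀ D → IsOrientation n (cycleGraph n) D → ∀ f → IsMODF n D f →
    - (+ n) +ℤ + (2 * ((n + 5) / 4)) ≤ℤ weight n f
  dom-lower D ori f modf = subst (_ ≤ℤ_) (sym (weight-positives n f))
    (weight-mono n (ceil-least n (positives n f) (modf-positives (forward D) f (≤-trans (n≤1+n 2) n≥3) half)))
    where
    half : n ≤ 2 * goodVertices (forward D) f
    half = subst (λ c → n ≤ 2 * c) (goodCount-local ori n≥3 f) modf

  dom-attained : Σ (Digraph n) λ D → IsOrientation n (cycleGraph n) D ×
    Σ (SignFun n) λ f → IsMODF n D f × weight n f ≡ - (+ n) +ℤ + (2 * ((n + 5) / 4))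
  dom-attained with ceil-window n n≥3
  ... | q , c≡q+1 , fits , half = D , ori , A , modf , weight-A
    where
    A : SignFun n
    A = alternating q
    D : Digraph n
    D = orient (not ∘ A)
    ori : IsOrientation n (cycleGraph n) D
    ori = orient-isOrientation n≥3 (not ∘ A)
    modf : IsMODF n D A
    modf = ≤-trans half (*-monoʳ-≤ 2 (≤-trans (alternating-count q fits) (≤-reflexive (sym count-eq))))
      where count-eq : goodCount n D A ≡ goodVertices (not ∘ A) A
            count-eq = trans (goodCount-local ori n≥3 A) (goodVertices-cong {f = A} (orient-forward n≥3 (not ∘ A)) (λ _ → refl))
    weight-A : weight n A ≡ - (+ n) +ℤ + (2 * ((n + 5) / 4))
    weight-A = trans (weight-positives n A)
                     (cong (λ c → - (+ n) +ℤ + (2 * c)) (trans (alternating-positives n q fits) (sym c≡q+1)))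

  directed : Digraph n
  directed = orient (λ _ → true)

  directed-modf : ∀ f → IsMODF n directed f → n + 2 ≤ 2 * positives n f ⊎ positives n f ≡ n
  directed-modf f modf = directed-positives (s≤s z≤n) f (subst (λ c → n ≤ 2 * c) count-eq modf)
    where count-eq : goodCount n directed f ≡ goodVertices (λ _ → true) f
          count-eq = trans (goodCount-local (orient-isOrientation n≥3 _) n≥3 f)
                           (goodVertices-cong {f = f} (orient-forward n≥3 (λ _ → true)) (λ _ → refl))

  -- If K < n ≤ 2K and 2(K + 1) = n + t, then DOM⁺_maj(C_n) = t provided every MODF of the
  -- directed cycle has weight at least t: windows give every orientation a MODF of weight t.
  DOM-from : ∀ K t → K < n → n ≤ 2 * K → 2 * suc K ≡ n + t →
    (∀ f → IsMODF n directed f → n + t ≤ 2 * positives n f) → IsDOMMaj n (cycleGraph n) (+ t)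
  DOM-from K t K<n n≤2K 2K+2≡n+t directed-lower =
    isDOMMaj-intro window-witness directed (orient-isOrientation n≥3 _) λ f modf →
      subst (+ t ≤ℤ_) (sym (weight-positives n f)) (weight-lower n t (positives n f) (directed-lower f modf))
    where
    window-witness : ∀ D → IsOrientation n (cycleGraph n) D →
      Σ (SignFun n) λ f → IsMODF n D f × weight n f ≡ + t
    window-witness D ori with window-modf (forward D) K K<n
    ... | f , K≤good , positives≡K+1 = f , modf , (begin
      weight n f                        ≡⟨ weight-positives n f ⟩
      - (+ n) +ℤ + (2 * positives n f)  ≡⟨ cong (λ p → - (+ n) +ℤ + (2 * p)) positives≡K+1 ⟩
      - (+ n) +ℤ + (2 * suc K)          ≡⟨ cong (λ x → - (+ n) +ℤ + x) 2K+2≡n+t ⟩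
      - (+ n) +ℤ + (n + t)              ≡⟨ weight-exact n t ⟩
      + t                               ∎)
      where
      open ≡-Reasoning
      modf : IsMODF n D f
      modf = ≤-trans n≤2K (*-monoʳ-≤ 2 (≤-trans K≤good (≤-reflexive (sym (goodCount-local ori n≥3 f)))))

  DOM-even : 2 ∣ n → IsDOMMaj n (cycleGraph n) (+ 2)
  DOM-even (divides zero    ())
  DOM-even (divides (suc k) n≡2k) = DOM-from (suc k) 2 k<n n≤2k (trans (identity k) (cong (λ x → x + 2) (sym n≡2k))) lower
    where
    identity : ∀ k → 2 * suc (suc k) ≡ suc k * 2 + 2
    identity = ℕSolver.solve-∀
    double : ∀ k → suc k * 2 ≡ suc k + suc k
    double = ℕSolver.solve-∀
    k<n : suc k < n
    k<n = subst (suc k <_) (sym (trans n≡2k (double k))) (m<m+n (suc k) (s≤s z≤n))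
    n≤2k : n ≤ 2 * suc k
    n≤2k = ≤-reflexive (trans n≡2k (*-comm (suc k) 2))
    lower : ∀ f → IsMODF n directed f → n + 2 ≤ 2 * positives n f
    lower f modf with directed-modf f modf
    ... | inj₁ n+2≤2p = n+2≤2p
    ... | inj₂ p≡n rewrite p≡n = n+t≤2n (≤-trans (n≤1+n 2) n≥3)

  DOM-odd : ¬ 2 ∣ n → IsDOMMaj n (cycleGraph n) (+ 3)
  DOM-odd n-odd with odd-form n n-odd
  ... | zero  , n≡1   = ⊥-elim (<-irrefl (sym n≡1) (≤-trans (s≤s (s≤s z≤n)) n≥3))
  ... | suc k , n≡2k+1 =
    DOM-from (suc (suc k)) 3 k+1<n n≤2k+2 (trans (identity k) (cong (λ x → x + 3) (sym n≡2k+1))) lower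
    where
    identity : ∀ k → 2 * suc (suc (suc k)) ≡ suc (suc k * 2) + 3
    identity = ℕSolver.solve-∀
    k+1<n : suc (suc k) < n
    k+1<n = subst (suc (suc k) <_) (sym (trans n≡2k+1 (split k))) (m<m+n (suc (suc k)) (s≤s z≤n))
      where split : ∀ k → suc (suc k * 2) ≡ suc (suc k) + suc k
            split = ℕSolver.solve-∀
    n≤2k+2 : n ≤ 2 * suc (suc k)
    n≤2k+2 = subst (_≤ 2 * suc (suc k)) (sym n≡2k+1) (≤-trans (n≤1+n _) (≤-reflexive (double-plus k)))
      where double-plus : ∀ k → suc (suc (suc k * 2)) ≡ 2 * suc (suc k)
            double-plus = ℕSolver.solve-∀
    lower : ∀ f → IsMODF n directed f → n + 3 ≤ 2 * positives n f
    lower f modf with directed-modf f modf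
    ... | inj₁ n+2≤2p = subst (λ x → x + 3 ≤ 2 * positives n f) (sym n≡2k+1)
                          (odd-improve (suc k) (positives n f) (subst (λ x → x + 2 ≤ 2 * positives n f) n≡2k+1 n+2≤2p))
    ... | inj₂ p≡n rewrite p≡n = n+t≤2n n≥3

proposition4p3 : (n : ℕ) → 3 ≤ n →
    IsDomMaj n (cycleGraph n) ((- (+ n)) +ℤ (+ (2 * ((n + 5) / 4))))
    × ((2 ∣ n → IsDOMMaj n (cycleGraph n) (+ 2))
       × (¬ (2 ∣ n) → IsDOMMaj n (cycleGraph n) (+ 3)))
proposition4p3 zero    ()
proposition4p3 (suc m) n≥3 =
    isDomMaj-intro (dom-lower n≥3) (dom-attained n≥3)
  , DOM-even n≥3
  , DOM-odd n≥3
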